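{- Let $G=(V,E)$, centralities, importances, $G_{2\text{ -hop}}$ and $H=(h_1,\dots,h_{|H|})$ be as in the context. Let $P_0$ be the partition of $V$ into singletons and, for $1\le t\le |H|$, let $P_t$ be obtained from $P_{t-1}$ by merging the two parts containing the endpoints of $h_t$ (leaving it unchanged if they are already in the same part). Let $\mathcal{G}^t$ denote the summary of $P_t$ (so $\mathcal{G}^0$ is $G$ itself). Then $u(\mathcal{G}^{t-1})\ge u(\mathcal{G}^t)$ for every $1\le t\le|H|$.
   Context: $G=(V,E)$ is a finite simple undirected graph with node centralities $(C_x)_{x\in V}$. Edge importances $C(u,v)>0$ for $\{u,v\}\in E$ sum to $1$; spurious importances $C_s(u,v)\ge0$ for non-adjacent distinct pairs $\{u,v\}$ sum to $1$. $F=\{\{a,c\}: a\neq c,\ \exists b \text{ with } \{a,b\},\{b,c\}\in E\}$, $G_{2\text{ -hop}}=(V,F)$ weighted by $w(a,c)=C_a+C_c$, and $H$ is the list of edges of a minimum spanning forest of $G_{2\text{ -hop}}$ sorted in nondecreasing order of weight. For a partition $\mathcal{V}$ of $V$ and parts $X,Y$ (possibly equal), $\mathrm{nSedge}(X,Y)$ is the sum of $C(x,y)$ over edges $\{x,y\}\in E$ with $x\in X,y\in Y$ (for $X=Y$: over unordered pairs of distinct nodes of $X$), and $\mathrm{Sedge}(X,Y)$ is the analogous sum of $C_s(x,y)$ over non-adjacent pairs. The summary of $\mathcal{V}$ has superedge $\{X,Y\}$ iff some edge of $G$ joins $X$ and $Y$ (lies inside $X$ if $X=Y$) and $\mathrm{Sedge}(X,Y)\le\mathrm{nSedge}(X,Y)$;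 its utility is $u=\sum_{\{X,Y\}\text{ superedge}}(\mathrm{nSedge}(X,Y)-\mathrm{Sedge}(X,Y))$.
   Formalization: The node centralities, the edge importances and the spurious importances all take rational values. -}

module Defs where

open import Data.Nat using (ℕ; zero; suc)
open import Data.Fin using (Fin; zero; suc; _<?_; _≤?_; _≟_)
open import Data.Bool using (Bool; true; false; if_then_else_; _∧_; _∨_; not; T)
open import Data.List using (List; []; _∷_; length; lookup; removeAt; foldl; take)
open import Data.List.Membership.Propositional using (_∈_)
open import Data.List.Relation.Unary.All using (All)
open import Data.List.Relation.Unary.Linked using (Linked)
open import Data.Product using (_×_; _,_; ∃; proj₁; proj₂)
open import Data.Sum using (_⊎_)
open import Relation.Nullary using (¬_)
open import Relation.Nullary.Decidable using (⌊_⌋)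
open import Relation.Binary.PropositionalEquality using (_≡_)
open import Data.Rational using (ℚ; 0ℚ; 1ℚ; _+_; _-_; _≤_; _<_)
import Data.Rational.Properties as ℚP

record SimpleGraph (n : ℕ) : Set where
  field
    adj    : Fin n → Fin n → Bool
    sym    : ∀ x y → adj x y ≡ adj y x
    irrefl : ∀ x → adj x x ≡ false
open SimpleGraph public

Σ : ∀ {n} → (Fin n → ℚ) → ℚ
Σ {zero}  f = 0ℚ
Σ {suc n} f = f zero + Σ (λ i → f (suc i))

anyF : ∀ {n} → (Fin n → Bool) → Bool
anyF {zero}  f = false
anyF {suc n} f = f zero ∨ anyF (λ i → f (suc i))

-- Sum over unordered pairs {x,y} of distinct vertices (represented by x < y)
-- satisfying a Boolean condition.
ΣPairs : ∀ {n} → (Fin n → Fin n → Bool) → (Fin n → Fin n → ℚ) → ℚ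
ΣPairs cond f = Σ (λ x → Σ (λ y → if ⌊ x <? y ⌋ ∧ cond x y then f x y else 0ℚ))

-- Edge importances C(u,v) > 0 on edges, summing to 1 (C read on x < y).
IsEdgeImportance : ∀ {n} → SimpleGraph n → (Fin n → Fin n → ℚ) → Set
IsEdgeImportance G C =
  (∀ x y → T ⌊ x <? y ⌋ → T (adj G x y) → 0ℚ < C x y)
  × ΣPairs (adj G) C ≡ 1ℚ

IsSpuriousImportance : ∀ {n} → SimpleGraph n → (Fin n → Fin n → ℚ) → Set
IsSpuriousImportance G Cs =
  (∀ x y → T ⌊ x <? y ⌋ → T (not (adj G x y)) → 0ℚ ≤ Cs x y)
  × ΣPairs (λ x y → not (adj G x y)) Cs ≡ 1ℚ

-- Partitions, represented by a labelling  p : V → Fin n  (parts = fibres).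

Labelling : ℕ → Set
Labelling n = Fin n → Fin n

pairIn : ∀ {n} → Labelling n → Fin n → Fin n → Fin n → Fin n → Bool
pairIn p i j x y = (⌊ p x ≟ i ⌋ ∧ ⌊ p y ≟ j ⌋) ∨ (⌊ p x ≟ j ⌋ ∧ ⌊ p y ≟ i ⌋)

nSedge : ∀ {n} → SimpleGraph n → (Fin n → Fin n → ℚ) → Labelling n → Fin n → Fin n → ℚ
nSedge G C p i j = ΣPairs (λ x y → adj G x y ∧ pairIn p i j x y) C

Sedge : ∀ {n} → SimpleGraph n → (Fin n → Fin n → ℚ) → Labelling n → Fin n → Fin n → ℚ
Sedge G Cs p i j = ΣPairs (λ x y → not (adj G x y) ∧ pairIn p i j x y) Cs

hasEdge : ∀ {n} → SimpleGraph n → Labelling n → Fin n → Fin n → Bool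
hasEdge G p i j = anyF (λ x → anyF (λ y → ⌊ x <? y ⌋ ∧ adj G x y ∧ pairIn p i j x y))

isSuperedge : ∀ {n} → SimpleGraph n → (C Cs : Fin n → Fin n → ℚ) → Labelling n → Fin n → Fin n → Bool
isSuperedge G C Cs p i j = hasEdge G p i j ∧ ⌊ Sedge G Cs p i j ℚP.≤? nSedge G C p i j ⌋

utility : ∀ {n} → SimpleGraph n → (C Cs : Fin n → Fin n → ℚ) → Labelling n → ℚ
utility G C Cs p =
  Σ (λ i → Σ (λ j → if ⌊ i ≤? j ⌋ ∧ isSuperedge G C Cs p i j
                     then nSedge G C p i j - Sedge G Cs p i j else 0ℚ))

merge : ∀ {n} → Labelling n → Fin n × Fin n → Labelling n
merge p (a , c) x = if ⌊ p x ≟ p c ⌋ then p a else p x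

partitionAt : ∀ {n} → List (Fin n × Fin n) → ℕ → Labelling n
partitionAt H t = foldl merge (λ x → x) (take t H)

TwoHop : ∀ {n} → SimpleGraph n → Fin n → Fin n → Set
TwoHop G a c = ¬ (a ≡ c) × ∃ (λ b → T (adj G a b) × T (adj G b c))

weight : ∀ {n} → (Fin n → ℚ) → Fin n × Fin n → ℚ
weight Cx (a , c) = Cx a + Cx c

data Reach {n} (R : Fin n → Fin n → Set) : Fin n → Fin n → Set where
  here : ∀ {x} → Reach R x x
  step : ∀ {x y z} → R x y → Reach R y z → Reach R x z

InList : ∀ {n} → List (Fin n × Fin n) → Fin n → Fin n → Set
InList T x y = ((x , y) ∈ T) ⊎ ((y , x) ∈ T)

totalWeight : ∀ {n} → (Fin n → ℚ) → List (Fin n × Fin n) → ℚ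
totalWeight Cx []       = 0ℚ
totalWeight Cx (e ∷ es) = weight Cx e + totalWeight Cx es

-- T is (the edge list of) a spanning forest of G_{2-hop}:
--  * every listed edge is an edge of G_{2-hop};
--  * acyclic: removing any listed edge disconnects its endpoints
--    (this also excludes repeated edges);
--  * spanning: any two vertices connected in G_{2-hop} are connected in T.
IsSpanningForest2Hop : ∀ {n} → SimpleGraph n → List (Fin n × Fin n) → Set
IsSpanningForest2Hop G T =
  All (λ e → TwoHop G (proj₁ e) (proj₂ e)) T
  × (∀ (k : Fin (length T)) →
       ¬ Reach (InList (removeAt T k)) (proj₁ (lookup T k)) (proj₂ (lookup T k)))
  × (∀ x y → Reach (TwoHop G) x y → Reach (InList T) x y)

IsMinSpanningForest2Hop : ∀ {n} → SimpleGraph n → (Fin n → ℚ) → List (Fin n × Fin n) → Set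
IsMinSpanningForest2Hop G Cx T =
  IsSpanningForest2Hop G T
  × (∀ T' → IsSpanningForest2Hop G T' → totalWeight Cx T ≤ totalWeight Cx T')

SortedByWeight : ∀ {n} → (Fin n → ℚ) → List (Fin n × Fin n) → Set
SortedByWeight Cx = Linked (λ e e' → weight Cx e ≤ weight Cx e')

{-# OPTIONS --safe #-}

-- Give each node pair the signed weight g = C on edges and g = - Cs on
-- non-edges. For two parts, nSedge - Sedge is the sum of g over the node
-- pairs joining them, and what the pair of parts contributes to the utility
-- is the positive part of this gain: a superedge needs Sedge ≤ nSedge, and
-- with no edge between the parts the gain is - Sedge ≤ 0 anyway. Merging
-- parts relabels p into r ∘ p; every unordered pair of old parts lies over
-- exactly one unordered pair of new parts, so each new gain is a sum of
-- old gains, and subadditivity of the positive part shows that the utility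
-- cannot grow. This holds for every merge.
module Submission where

open import Defs hiding (sym)
import Data.Rational.Properties as ℚ
open import Algebra.Properties.CommutativeMonoid.Sum ℚ.+-0-commutativeMonoid
  using (sum; ∑-distrib-+)
open import Data.Bool using (Bool; true; false; if_then_else_; _∧_; _∨_; not; T)
open import Data.Bool.Properties using (∧-comm; ∨-comm; ∨-conicalˡ; ∨-conicalʳ; T-∧)
open import Data.Empty using (⊥-elim)
open import Data.Fin using (Fin; zero; suc; toℕ; fromℕ<; _≟_; _≤?_; _<?_)
import Data.Fin as Fin
open import Data.Fin.Properties using (toℕ-fromℕ<)
import Data.Fin.Properties as Finₚ
open import Data.List using (List; length; lookup; foldl; take)
open import Data.List.Properties using (take-suc; foldl-∷ʳ)
open import Data.Nat using (ℕ; zero; suc; _∸_)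
import Data.Nat as ℕ
open import Data.Product using (_×_; _,_; proj₁)
open import Data.Rational using (ℚ; 0ℚ; _+_; _-_; -_; _≤_; _⊔_)
open import Data.Sum using (inj₁; inj₂)
open import Function using (_∘_; Equivalence)
open import Relation.Binary.PropositionalEquality
  using (_≡_; refl; sym; trans; cong; cong₂; subst; subst₂; module ≡-Reasoning)
open import Relation.Nullary using (yes; no)
open import Relation.Nullary.Decidable using (⌊_⌋; ⌊⌋-map′)

private
  variable
    n : ℕ

when : Bool → ℚ → ℚ
when c v = if c then v else 0ℚ

when-∧ : ∀ c d v → when (c ∧ d) v ≡ when c (when d v)
when-∧ true  d v = refl
when-∧ false d v = refl

when-comm : ∀ c d v → when c (when d v) ≡ when d (when c v)
when-comm true  d     v = refl
when-comm false true  v = refl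
when-comm false false v = refl

when-exchange : ∀ a b c v → when a (when (b ∧ c) v) ≡ when b (when (a ∧ c) v)
when-exchange true  b     c v = when-∧ b c v
when-exchange false true  c v = refl
when-exchange false false c v = refl

when-shuffle : ∀ a b c d v → when a (when (b ∧ c) (when d v)) ≡ when (b ∧ d) (when (a ∧ c) v)
when-shuffle true  true  c d     v = when-comm c d v
when-shuffle true  false c d     v = refl
when-shuffle false false c d     v = refl
when-shuffle false true  c true  v = refl
when-shuffle false true  c false v = refl

when-mono-≤ : ∀ c {u v} → u ≤ v → when c u ≤ when c v
when-mono-≤ true  u≤v = u≤v
when-mono-≤ false _   = ℚ.≤-refl

when-nonneg : ∀ c {v} → (T c → 0ℚ ≤ v) → 0ℚ ≤ when c v
when-nonneg true  0≤v = 0≤v _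
when-nonneg false _   = ℚ.≤-refl

Σ-cong : {f g : Fin n → ℚ} → (∀ i → f i ≡ g i) → Σ f ≡ Σ g
Σ-cong {zero}  f≗g = refl
Σ-cong {suc n} f≗g = cong₂ _+_ (f≗g zero) (Σ-cong (f≗g ∘ suc))

Σ-zero : Σ {n} (λ _ → 0ℚ) ≡ 0ℚ
Σ-zero {zero}  = refl
Σ-zero {suc n} = trans (ℚ.+-identityˡ _) (Σ-zero {n})

Σ≡sum : (f : Fin n → ℚ) → Σ f ≡ sum f
Σ≡sum {zero}  f = refl
Σ≡sum {suc n} f = cong (f zero +_) (Σ≡sum (f ∘ suc))

Σ-distrib-+ : (f g : Fin n → ℚ) → Σ (λ i → f i + g i) ≡ Σ f + Σ g
Σ-distrib-+ f g = begin
  Σ (λ i → f i + g i)    ≡⟨ Σ≡sum (λ i → f i + g i) ⟩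
  sum (λ i → f i + g i)  ≡⟨ ∑-distrib-+ f g ⟩
  sum f + sum g          ≡⟨ sym (cong₂ _+_ (Σ≡sum f) (Σ≡sum g)) ⟩
  Σ f + Σ g              ∎
  where open ≡-Reasoning

Σ-neg : (f : Fin n → ℚ) → Σ (λ i → - f i) ≡ - Σ f
Σ-neg {zero}  f = refl
Σ-neg {suc n} f =
  trans (cong (- f zero +_) (Σ-neg (f ∘ suc))) (sym (ℚ.neg-distrib-+ (f zero) _))

Σ-distrib-- : (f g : Fin n → ℚ) → Σ (λ i → f i - g i) ≡ Σ f - Σ g
Σ-distrib-- f g = trans (Σ-distrib-+ f (λ i → - g i)) (cong (Σ f +_) (Σ-neg g))

Σ-comm : ∀ {m} (f : Fin m → Fin n → ℚ) →
         Σ (λ i → Σ (λ j → f i j)) ≡ Σ (λ j → Σ (λ i → f i j))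
Σ-comm {n} {zero}  f = sym (Σ-zero {n})
Σ-comm {n} {suc m} f =
  trans (cong (Σ (f zero) +_) (Σ-comm (f ∘ suc))) (sym (Σ-distrib-+ (f zero) _))

Σ-mono-≤ : {f g : Fin n → ℚ} → (∀ i → f i ≤ g i) → Σ f ≤ Σ g
Σ-mono-≤ {zero}  f≤g = ℚ.≤-refl
Σ-mono-≤ {suc n} f≤g = ℚ.+-mono-≤ (f≤g zero) (Σ-mono-≤ (f≤g ∘ suc))

Σ-nonneg : {f : Fin n → ℚ} → (∀ i → 0ℚ ≤ f i) → 0ℚ ≤ Σ f
Σ-nonneg {n} {f} 0≤f = subst (_≤ Σ f) (Σ-zero {n}) (Σ-mono-≤ 0≤f)

Σ-when : ∀ c (f : Fin n → ℚ) → Σ (λ i → when c (f i)) ≡ when c (Σ f)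
Σ-when     true  f = refl
Σ-when {n} false f = Σ-zero {n}

Σ-delta : (a : Fin n) (f : Fin n → ℚ) → Σ (λ i → when ⌊ a ≟ i ⌋ (f i)) ≡ f a
Σ-delta {suc n} zero    f = trans (cong (f zero +_) (Σ-zero {n})) (ℚ.+-identityʳ _)
Σ-delta {suc n} (suc a) f =
  trans (ℚ.+-identityˡ _) (trans (Σ-cong suc≟suc) (Σ-delta a (f ∘ suc)))
  where
  suc≟suc : ∀ i → when ⌊ suc a ≟ suc i ⌋ (f (suc i)) ≡ when ⌊ a ≟ i ⌋ (f (suc i))
  suc≟suc i = cong (λ c → when c (f (suc i))) (⌊⌋-map′ (cong suc) Finₚ.suc-injective (a ≟ i))

Σ² : (Fin n → Fin n → ℚ) → ℚ
Σ² f = Σ (λ i → Σ (f i))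

Σ²-cong : {f g : Fin n → Fin n → ℚ} → (∀ i j → f i j ≡ g i j) → Σ² f ≡ Σ² g
Σ²-cong f≗g = Σ-cong (λ i → Σ-cong (f≗g i))

Σ²-mono-≤ : {f g : Fin n → Fin n → ℚ} → (∀ i j → f i j ≤ g i j) → Σ² f ≤ Σ² g
Σ²-mono-≤ f≤g = Σ-mono-≤ (λ i → Σ-mono-≤ (f≤g i))

Σ²-when : ∀ c (f : Fin n → Fin n → ℚ) → Σ² (λ i j → when c (f i j)) ≡ when c (Σ² f)
Σ²-when c f = trans (Σ-cong (λ i → Σ-when c (f i))) (Σ-when c (λ i → Σ (f i)))

Σ²-comm : (f : Fin n → Fin n → Fin n → Fin n → ℚ) →
          Σ² (λ i j → Σ² (λ k l → f i j k l)) ≡ Σ² (λ k l → Σ² (λ i j → f i j k l))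
Σ²-comm f = begin
  Σ (λ i → Σ (λ j → Σ (λ k → Σ (λ l → f i j k l))))
    ≡⟨ Σ-cong (λ i → Σ-comm (λ j k → Σ (λ l → f i j k l))) ⟩
  Σ (λ i → Σ (λ k → Σ (λ j → Σ (λ l → f i j k l))))
    ≡⟨ Σ-comm (λ i k → Σ (λ j → Σ (λ l → f i j k l))) ⟩
  Σ (λ k → Σ (λ i → Σ (λ j → Σ (λ l → f i j k l))))
    ≡⟨ Σ-cong (λ k → Σ-cong (λ i → Σ-comm (λ j l → f i j k l))) ⟩
  Σ (λ k → Σ (λ i → Σ (λ l → Σ (λ j → f i j k l))))
    ≡⟨ Σ-cong (λ k → Σ-comm (λ i l → Σ (λ j → f i j k l))) ⟩
  Σ (λ k → Σ (λ l → Σ (λ i → Σ (λ j → f i j k l)))) ∎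
  where open ≡-Reasoning

Σ²-when-exchange : (a : Fin n → Fin n → Bool) (s : Fin n → Fin n → Fin n → Fin n → Bool)
                   (v : Fin n → Fin n → ℚ) →
  Σ² (λ k l → when (a k l) (Σ² (λ i j → when (a i j ∧ s i j k l) (v i j)))) ≡
  Σ² (λ i j → when (a i j) (Σ² (λ k l → when (a k l ∧ s i j k l) (v i j))))
Σ²-when-exchange a s v = begin
  Σ² (λ k l → when (a k l) (Σ² (λ i j → when (a i j ∧ s i j k l) (v i j))))
    ≡⟨ Σ²-cong (λ k l → sym (Σ²-when (a k l) (λ i j → when (a i j ∧ s i j k l) (v i j)))) ⟩
  Σ² (λ k l → Σ² (λ i j → when (a k l) (when (a i j ∧ s i j k l) (v i j))))
    ≡⟨ Σ²-comm (λ k l i j → when (a k l) (when (a i j ∧ s i j k l) (v i j))) ⟩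
  Σ² (λ i j → Σ² (λ k l → when (a k l) (when (a i j ∧ s i j k l) (v i j))))
    ≡⟨ Σ²-cong (λ i j → Σ²-cong (λ k l → when-exchange (a k l) (a i j) (s i j k l) (v i j))) ⟩
  Σ² (λ i j → Σ² (λ k l → when (a i j) (when (a k l ∧ s i j k l) (v i j))))
    ≡⟨ Σ²-cong (λ i j → Σ²-when (a i j) (λ k l → when (a k l ∧ s i j k l) (v i j))) ⟩
  Σ² (λ i j → when (a i j) (Σ² (λ k l → when (a k l ∧ s i j k l) (v i j)))) ∎
  where open ≡-Reasoning

Σ²-zero : Σ² {n} (λ _ _ → 0ℚ) ≡ 0ℚ
Σ²-zero {n} = trans (Σ-cong {n} (λ _ → Σ-zero {n})) (Σ-zero {n})

Σ²-distrib-- : (f g : Fin n → Fin n → ℚ) →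
               Σ² (λ i j → f i j - g i j) ≡ Σ² f - Σ² g
Σ²-distrib-- f g =
  trans (Σ-cong (λ i → Σ-distrib-- (f i) (g i))) (Σ-distrib-- (λ i → Σ (f i)) (λ i → Σ (g i)))

Σ²-nonneg : {f : Fin n → Fin n → ℚ} → (∀ i j → 0ℚ ≤ f i j) → 0ℚ ≤ Σ² f
Σ²-nonneg 0≤f = Σ-nonneg (λ i → Σ-nonneg (0≤f i))

anyF-false : (f : Fin n → Bool) → anyF f ≡ false → ∀ i → f i ≡ false
anyF-false {suc n} f none zero    = ∨-conicalˡ _ _ none
anyF-false {suc n} f none (suc i) = anyF-false (f ∘ suc) (∨-conicalʳ _ _ none) i

Σ²-when-none : (c : Fin n → Fin n → Bool) (f : Fin n → Fin n → ℚ) →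
               anyF (λ i → anyF (c i)) ≡ false → Σ² (λ i j → when (c i j) (f i j)) ≡ 0ℚ
Σ²-when-none {n} c f none = trans (Σ²-cong vanish) (Σ²-zero {n})
  where
  vanish : ∀ i j → when (c i j) (f i j) ≡ 0ℚ
  vanish i j = cong (λ b → when b (f i j)) (anyF-false (c i) (anyF-false _ none i) j)

infix 10 _⁺

_⁺ : ℚ → ℚ
v ⁺ = v ⊔ 0ℚ

⁺-subadditive : ∀ u v → (u + v) ⁺ ≤ u ⁺ + v ⁺
⁺-subadditive u v = ℚ.⊔-lub (ℚ.+-mono-≤ (ℚ.p≤p⊔q u 0ℚ) (ℚ.p≤p⊔q v 0ℚ))
                            (ℚ.+-mono-≤ (ℚ.p≤q⊔p u 0ℚ) (ℚ.p≤q⊔p v 0ℚ))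

Σ-⁺ : (f : Fin n → ℚ) → Σ f ⁺ ≤ Σ (λ i → f i ⁺)
Σ-⁺ {zero}  f = ℚ.≤-reflexive (ℚ.⊔-idem 0ℚ)
Σ-⁺ {suc n} f =
  ℚ.≤-trans (⁺-subadditive (f zero) _) (ℚ.+-monoʳ-≤ (f zero ⁺) (Σ-⁺ (f ∘ suc)))

Σ²-⁺ : (f : Fin n → Fin n → ℚ) → Σ² f ⁺ ≤ Σ² (λ i j → f i j ⁺)
Σ²-⁺ f = ℚ.≤-trans (Σ-⁺ (λ i → Σ (f i))) (Σ-mono-≤ (λ i → Σ-⁺ (f i)))

when-⁺ : ∀ c v → when c v ⁺ ≡ when c (v ⁺)
when-⁺ true  v = refl
when-⁺ false v = ℚ.⊔-idem 0ℚ

p≤q⇒p-q≤0 : ∀ {p q} → p ≤ q → p - q ≤ 0ℚ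
p≤q⇒p-q≤0 {p} {q} p≤q = subst (p - q ≤_) (ℚ.+-inverseʳ q) (ℚ.+-monoˡ-≤ (- q) p≤q)

p≤q⇒0≤q-p : ∀ {p q} → p ≤ q → 0ℚ ≤ q - p
p≤q⇒0≤q-p {p} {q} p≤q = subst (_≤ q - p) (ℚ.+-inverseʳ p) (ℚ.+-monoˡ-≤ (- p) p≤q)

p≤q⇒[p-q]⁺≡0 : ∀ {p q} → p ≤ q → (p - q) ⁺ ≡ 0ℚ
p≤q⇒[p-q]⁺≡0 p≤q = ℚ.p≤q⇒p⊔q≡q (p≤q⇒p-q≤0 p≤q)

[p-q]⁺≡when-q≤p : ∀ p q → (p - q) ⁺ ≡ when ⌊ q ℚ.≤? p ⌋ (p - q)
[p-q]⁺≡when-q≤p p q with q ℚ.≤? p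
... | yes q≤p = ℚ.p≥q⇒p⊔q≡p (p≤q⇒0≤q-p q≤p)
... | no  q≰p = p≤q⇒[p-q]⁺≡0 (ℚ.<⇒≤ (ℚ.≰⇒> q≰p))

samePair : Fin n → Fin n → Fin n → Fin n → Bool
samePair a b i j = pairIn (λ x → x) i j a b

samePair-comm : ∀ (a b i j : Fin n) → samePair a b i j ≡ samePair b a i j
samePair-comm a b i j =
  trans (cong₂ _∨_ (∧-comm ⌊ a ≟ i ⌋ ⌊ b ≟ j ⌋) (∧-comm ⌊ a ≟ j ⌋ ⌊ b ≟ i ⌋))
        (∨-comm (⌊ b ≟ j ⌋ ∧ ⌊ a ≟ i ⌋) (⌊ b ≟ i ⌋ ∧ ⌊ a ≟ j ⌋))

sorted-samePair : ∀ {a b : Fin n} → a Fin.≤ b → ∀ i j →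
                  ⌊ i ≤? j ⌋ ∧ samePair a b i j ≡ ⌊ a ≟ i ⌋ ∧ ⌊ b ≟ j ⌋
sorted-samePair {a = a} {b} a≤b i j with a ≟ i | b ≟ j
... | yes refl | yes refl with a ≤? b
...   | yes _   = refl
...   | no  a≰b = ⊥-elim (a≰b a≤b)
sorted-samePair {a = a} {b} a≤b i j | yes refl | no b≢j with a ≟ j | b ≟ a | a ≤? j
...   | yes refl | yes refl | _     = ⊥-elim (b≢j refl)
...   | yes _    | no _     | yes _ = refl
...   | no _     | _        | yes _ = refl
...   | _        | _        | no _  = refl
sorted-samePair {a = a} {b} a≤b i j | no a≢i | _ with a ≟ j | b ≟ i | i ≤? j
...   | yes refl | yes refl | yes i≤j = ⊥-elim (a≢i (Finₚ.≤-antisym a≤b i≤j))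
...   | yes _    | no _     | yes _   = refl
...   | no _     | _        | yes _   = refl
...   | _        | _        | no _    = refl

Σ²-delta : ∀ (a b : Fin n) (f : Fin n → Fin n → ℚ) →
           Σ² (λ i j → when ⌊ a ≟ i ⌋ (when ⌊ b ≟ j ⌋ (f i j))) ≡ f a b
Σ²-delta a b f = begin
  Σ (λ i → Σ (λ j → when ⌊ a ≟ i ⌋ (when ⌊ b ≟ j ⌋ (f i j))))
    ≡⟨ Σ-cong (λ i → Σ-when ⌊ a ≟ i ⌋ (λ j → when ⌊ b ≟ j ⌋ (f i j))) ⟩
  Σ (λ i → when ⌊ a ≟ i ⌋ (Σ (λ j → when ⌊ b ≟ j ⌋ (f i j))))
    ≡⟨ Σ-delta a (λ i → Σ (λ j → when ⌊ b ≟ j ⌋ (f i j))) ⟩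
  Σ (λ j → when ⌊ b ≟ j ⌋ (f a j))
    ≡⟨ Σ-delta b (f a) ⟩
  f a b ∎
  where open ≡-Reasoning

Σ²-samePair-sorted : ∀ {a b : Fin n} → a Fin.≤ b → (f : Fin n → Fin n → ℚ) →
                     Σ² (λ i j → when (⌊ i ≤? j ⌋ ∧ samePair a b i j) (f i j)) ≡ f a b
Σ²-samePair-sorted {a = a} {b} a≤b f = trans (Σ²-cong unpair) (Σ²-delta a b f)
  where
  unpair : ∀ i j → when (⌊ i ≤? j ⌋ ∧ samePair a b i j) (f i j)
                 ≡ when ⌊ a ≟ i ⌋ (when ⌊ b ≟ j ⌋ (f i j))
  unpair i j = trans (cong (λ c → when c (f i j)) (sorted-samePair a≤b i j))
                     (when-∧ ⌊ a ≟ i ⌋ ⌊ b ≟ j ⌋ (f i j))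

Σ²-samePair : (f : Fin n → Fin n → ℚ) → (∀ i j → f i j ≡ f j i) → ∀ a b →
              Σ² (λ i j → when (⌊ i ≤? j ⌋ ∧ samePair a b i j) (f i j)) ≡ f a b
Σ²-samePair f f-sym a b with Finₚ.≤-total a b
... | inj₁ a≤b = Σ²-samePair-sorted a≤b f
... | inj₂ b≤a = trans (Σ²-cong swap) (trans (Σ²-samePair-sorted b≤a f) (f-sym b a))
  where
  swap : ∀ i j → when (⌊ i ≤? j ⌋ ∧ samePair a b i j) (f i j)
               ≡ when (⌊ i ≤? j ⌋ ∧ samePair b a i j) (f i j)
  swap i j = cong (λ c → when (⌊ i ≤? j ⌋ ∧ c) (f i j)) (samePair-comm a b i j)

blockSum : Labelling n → (Fin n → Fin n → ℚ) → Fin n → Fin n → ℚ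
blockSum p g i j = ΣPairs (pairIn p i j) g

blockSum-coarsen : ∀ (p r : Labelling n) g k l →
  blockSum (r ∘ p) g k l ≡
  Σ² (λ i j → when (⌊ i ≤? j ⌋ ∧ samePair (r i) (r j) k l) (blockSum p g i j))
blockSum-coarsen {n} p r g k l = begin
  Σ² (λ x y → when (⌊ x <? y ⌋ ∧ R (p x) (p y)) (g x y))  ≡⟨ Σ²-cong split ⟩
  Σ² (λ x y → Σ² (λ i j → when (sorted-R i j) (term x y i j)))
    ≡⟨ Σ²-comm (λ x y i j → when (sorted-R i j) (term x y i j)) ⟩
  Σ² (λ i j → Σ² (λ x y → when (sorted-R i j) (term x y i j)))
    ≡⟨ Σ²-cong (λ i j → Σ²-when (sorted-R i j) (λ x y → term x y i j)) ⟩
  Σ² (λ i j → when (sorted-R i j) (blockSum p g i j))     ∎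
  where
  open ≡-Reasoning
  R sorted-R : Fin n → Fin n → Bool
  R i j = samePair (r i) (r j) k l
  sorted-R i j = ⌊ i ≤? j ⌋ ∧ R i j
  term : Fin n → Fin n → Fin n → Fin n → ℚ
  term x y i j = when (⌊ x <? y ⌋ ∧ samePair (p x) (p y) i j) (g x y)
  R-sym : ∀ v i j → when (R i j) v ≡ when (R j i) v
  R-sym v i j = cong (λ c → when c v) (samePair-comm (r i) (r j) k l)
  onSorted : Fin n → Fin n → Fin n → Fin n → ℚ
  onSorted x y i j = when (⌊ i ≤? j ⌋ ∧ samePair (p x) (p y) i j) (when (R i j) (g x y))
  split : ∀ x y → when (⌊ x <? y ⌋ ∧ R (p x) (p y)) (g x y)
                ≡ Σ² (λ i j → when (sorted-R i j) (term x y i j))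
  split x y = begin
    when (⌊ x <? y ⌋ ∧ R (p x) (p y)) (g x y)
      ≡⟨ when-∧ ⌊ x <? y ⌋ (R (p x) (p y)) (g x y) ⟩
    when ⌊ x <? y ⌋ (when (R (p x) (p y)) (g x y))
      ≡⟨ cong (when ⌊ x <? y ⌋) (sym (Σ²-samePair (λ i j → when (R i j) (g x y))
                                                  (R-sym (g x y)) (p x) (p y))) ⟩
    when ⌊ x <? y ⌋ (Σ² (onSorted x y))
      ≡⟨ sym (Σ²-when ⌊ x <? y ⌋ (onSorted x y)) ⟩
    Σ² (λ i j → when ⌊ x <? y ⌋ (onSorted x y i j))
      ≡⟨ Σ²-cong (λ i j → when-shuffle ⌊ x <? y ⌋ ⌊ i ≤? j ⌋ _ (R i j) (g x y)) ⟩
    Σ² (λ i j → when (sorted-R i j) (term x y i j)) ∎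

posUtility : Labelling n → (Fin n → Fin n → ℚ) → ℚ
posUtility p g = Σ² (λ i j → when ⌊ i ≤? j ⌋ (blockSum p g i j ⁺))

posUtility-coarsen : ∀ (p r : Labelling n) g → posUtility (r ∘ p) g ≤ posUtility p g
posUtility-coarsen {n} p r g = begin
  Σ² (λ k l → when ⌊ k ≤? l ⌋ (blockSum (r ∘ p) g k l ⁺))
    ≡⟨ Σ²-cong (λ k l → cong (λ v → when ⌊ k ≤? l ⌋ (v ⁺)) (blockSum-coarsen p r g k l)) ⟩
  Σ² (λ k l → when ⌊ k ≤? l ⌋ (Σ² (λ i j → when (⌊ i ≤? j ⌋ ∧ R i j k l) (B i j)) ⁺))
    ≤⟨ Σ²-mono-≤ (λ k l → when-mono-≤ ⌊ k ≤? l ⌋ (⁺-inside k l)) ⟩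
  Σ² (λ k l → when ⌊ k ≤? l ⌋ (Σ² (λ i j → when (⌊ i ≤? j ⌋ ∧ R i j k l) (B i j ⁺))))
    ≡⟨ Σ²-when-exchange (λ i j → ⌊ i ≤? j ⌋) R (λ i j → B i j ⁺) ⟩
  Σ² (λ i j → when ⌊ i ≤? j ⌋ (Σ² (λ k l → when (⌊ k ≤? l ⌋ ∧ R i j k l) (B i j ⁺))))
    ≡⟨ Σ²-cong (λ i j → cong (when ⌊ i ≤? j ⌋)
                         (Σ²-samePair (λ _ _ → B i j ⁺) (λ _ _ → refl) (r i) (r j))) ⟩
  Σ² (λ i j → when ⌊ i ≤? j ⌋ (B i j ⁺))                                               ∎
  where
  open ℚ.≤-Reasoning
  B : Fin n → Fin n → ℚ
  B = blockSum p g
  R : Fin n → Fin n → Fin n → Fin n → Bool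
  R i j = samePair (r i) (r j)
  ⁺-inside : ∀ k l → Σ² (λ i j → when (⌊ i ≤? j ⌋ ∧ R i j k l) (B i j)) ⁺
                   ≤ Σ² (λ i j → when (⌊ i ≤? j ⌋ ∧ R i j k l) (B i j ⁺))
  ⁺-inside k l = ℚ.≤-trans (Σ²-⁺ (λ i j → when (⌊ i ≤? j ⌋ ∧ R i j k l) (B i j)))
                   (ℚ.≤-reflexive (Σ²-cong (λ i j → when-⁺ (⌊ i ≤? j ⌋ ∧ R i j k l) (B i j))))

partitionAt-suc : (H : List (Fin n × Fin n)) (i : Fin (length H)) →
                  partitionAt H (suc (toℕ i)) ≡ merge (partitionAt H (toℕ i)) (lookup H i)
partitionAt-suc H i = trans (cong (foldl merge (λ x → x)) (take-suc H i))
                            (foldl-∷ʳ merge (λ x → x) (lookup H i) (take (toℕ i) H))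

module _ (G : SimpleGraph n) (C Cs : Fin n → Fin n → ℚ) where

  signedWeight : Fin n → Fin n → ℚ
  signedWeight x y = if adj G x y then C x y else - Cs x y

  nSedge-Sedge≡blockSum : ∀ p i j →
    nSedge G C p i j - Sedge G Cs p i j ≡ blockSum p signedWeight i j
  nSedge-Sedge≡blockSum p i j =
    trans (sym (Σ²-distrib-- edgeTerm nonEdgeTerm))
          (Σ²-cong (λ x y → combine ⌊ x <? y ⌋ (adj G x y) (pairIn p i j x y) (C x y) (Cs x y)))
    where
    edgeTerm nonEdgeTerm : Fin n → Fin n → ℚ
    edgeTerm    x y = when (⌊ x <? y ⌋ ∧ adj G x y ∧ pairIn p i j x y) (C x y)
    nonEdgeTerm x y = when (⌊ x <? y ⌋ ∧ not (adj G x y) ∧ pairIn p i j x y) (Cs x y)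
    combine : ∀ lt e π u v →
      when (lt ∧ e ∧ π) u - when (lt ∧ not e ∧ π) v ≡ when (lt ∧ π) (if e then u else - v)
    combine false e     π     u v = refl
    combine true  true  true  u v = ℚ.+-identityʳ u
    combine true  true  false u v = refl
    combine true  false true  u v = ℚ.+-identityˡ (- v)
    combine true  false false u v = refl

  module _ (Cs≥0 : ∀ x y → T ⌊ x <? y ⌋ → T (not (adj G x y)) → 0ℚ ≤ Cs x y) where

    Sedge-nonneg : ∀ p i j → 0ℚ ≤ Sedge G Cs p i j
    Sedge-nonneg p i j = Σ²-nonneg (λ x y → when-nonneg (nonEdge x y) (Cs≥0′ x y))
      where
      nonEdge : Fin n → Fin n → Bool
      nonEdge x y = ⌊ x <? y ⌋ ∧ not (adj G x y) ∧ pairIn p i j x y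
      Cs≥0′ : ∀ x y → T (nonEdge x y) → 0ℚ ≤ Cs x y
      Cs≥0′ x y t with Equivalence.to T-∧ t
      ... | x<y , t′ = Cs≥0 x y x<y (proj₁ (Equivalence.to T-∧ t′))

    gain-when-superedge : ∀ p i j →
      let gain = nSedge G C p i j - Sedge G Cs p i j in
      when (isSuperedge G C Cs p i j) gain ≡ gain ⁺
    gain-when-superedge p i j with hasEdge G p i j in edges
    ... | true  = sym ([p-q]⁺≡when-q≤p (nSedge G C p i j) (Sedge G Cs p i j))
    ... | false =
      sym (p≤q⇒[p-q]⁺≡0 (subst (_≤ Sedge G Cs p i j) (sym nSedge≡0) (Sedge-nonneg p i j)))
      where
      nSedge≡0 : nSedge G C p i j ≡ 0ℚ
      nSedge≡0 = Σ²-when-none (λ x y → ⌊ x <? y ⌋ ∧ adj G x y ∧ pairIn p i j x y) C edges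

    utility≡posUtility : ∀ p → utility G C Cs p ≡ posUtility p signedWeight
    utility≡posUtility p = Σ²-cong (λ i j → begin
      when (⌊ i ≤? j ⌋ ∧ isSuperedge G C Cs p i j) (gain i j)
        ≡⟨ when-∧ ⌊ i ≤? j ⌋ (isSuperedge G C Cs p i j) (gain i j) ⟩
      when ⌊ i ≤? j ⌋ (when (isSuperedge G C Cs p i j) (gain i j))
        ≡⟨ cong (when ⌊ i ≤? j ⌋) (gain-when-superedge p i j) ⟩
      when ⌊ i ≤? j ⌋ (gain i j ⁺)
        ≡⟨ cong (λ v → when ⌊ i ≤? j ⌋ (v ⁺)) (nSedge-Sedge≡blockSum p i j) ⟩
      when ⌊ i ≤? j ⌋ (blockSum p signedWeight i j ⁺) ∎)
      where
      open ≡-Reasoning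
      gain : Fin n → Fin n → ℚ
      gain i j = nSedge G C p i j - Sedge G Cs p i j

    utility-coarsen : ∀ (p r : Labelling n) → utility G C Cs (r ∘ p) ≤ utility G C Cs p
    utility-coarsen p r = subst₂ _≤_ (sym (utility≡posUtility (r ∘ p))) (sym (utility≡posUtility p))
                                     (posUtility-coarsen p r signedWeight)

    utility-merge : ∀ p ac → utility G C Cs (merge p ac) ≤ utility G C Cs p
    utility-merge p (a , c) = utility-coarsen p (λ y → if ⌊ y ≟ p c ⌋ then p a else y)

    utility-partitionAt-suc : (H : List (Fin n × Fin n)) (i : Fin (length H)) →
      utility G C Cs (partitionAt H (suc (toℕ i))) ≤ utility G C Cs (partitionAt H (toℕ i))
    utility-partitionAt-suc H i =
      subst (λ q → utility G C Cs q ≤ utility G C Cs (partitionAt H (toℕ i)))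
            (sym (partitionAt-suc H i)) (utility-merge (partitionAt H (toℕ i)) (lookup H i))

theorem4p2 : (n : ℕ) (G : SimpleGraph n) (Cx : Fin n → ℚ) (C Cs : Fin n → Fin n → ℚ)
    → IsEdgeImportance G C → IsSpuriousImportance G Cs
    → (H : List (Fin n × Fin n))
    → IsMinSpanningForest2Hop G Cx H → SortedByWeight Cx H
    → (t : ℕ) → 1 ℕ.≤ t → t ℕ.≤ length H
    → utility G C Cs (partitionAt H t) ≤ utility G C Cs (partitionAt H (t ∸ 1))
theorem4p2 n G Cx C Cs _ (Cs≥0 , _) H _ _ (suc t) _ t<∣H∣ =
  subst (λ m → utility G C Cs (partitionAt H (suc m)) ≤ utility G C Cs (partitionAt H m))
        (toℕ-fromℕ< t<∣H∣)
        (utility-partitionAt-suc G C Cs Cs≥0 H (fromℕ< t<∣H∣))
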